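{- Let $q$ and $x$ be indeterminates, $[n]=\frac{1-q^n}{1-q}$, $[n]!=[1]\cdots[n]$ (with $[0]!=1$). Define the $q$-Hermite polynomials by $H_0(x)=1$, $H_1(x)=x$ and $H_n(x)=xH_{n-1}(x)-[n-1]H_{n-2}(x)$ for $n\ge2$. Then for every $n\ge1$, $$\det\left(H_{i+j}(x)\right)_{i,j=0}^{n-1}=(-1)^{\binom{n}{2}}q^{\binom{n}{3}}\prod_{j=0}^{n-1}[j]!.$$ -}

module Defs where

open import Level using (Level)
open import Algebra.Bundles using (CommutativeRing)
open import Data.Nat using (ℕ; zero; suc)
open import Data.Fin using (Fin; zero; suc; toℕ; punchIn)

module _ {c ℓ : Level} (R : CommutativeRing c ℓ) where
  open CommutativeRing R using (Carrier; 0#; 1#; _+_; _*_; -_; _-_)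

  sumFin : (n : ℕ) → (Fin n → Carrier) → Carrier
  sumFin zero    f = 0#
  sumFin (suc n) f = f zero + sumFin n (λ j → f (suc j))

  prodℕ : ℕ → (ℕ → Carrier) → Carrier
  prodℕ zero    f = 1#
  prodℕ (suc n) f = prodℕ n f * f n

  pow : Carrier → ℕ → Carrier
  pow a zero    = 1#
  pow a (suc n) = pow a n * a

  sign : ℕ → Carrier
  sign zero    = 1#
  sign (suc n) = - sign n

  -- q-integer [n] = (1 - q^n)/(1 - q) = 1 + q + ... + q^(n-1)
  qint : Carrier → ℕ → Carrier
  qint q n = sumFin n (λ i → pow q (toℕ i))

  qfact : Carrier → ℕ → Carrier
  qfact q n = prodℕ n (λ i → qint q (suc i))

  hermite : Carrier → Carrier → ℕ → Carrier
  hermite q x zero          = 1#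
  hermite q x (suc zero)    = x
  hermite q x (suc (suc n)) = x * hermite q x (suc n) - qint q (suc n) * hermite q x n

  det : (n : ℕ) → (Fin n → Fin n → Carrier) → Carrier
  det zero    M = 1#
  det (suc n) M =
    sumFin (suc n) (λ j → sign (toℕ j) * (M zero j * det n (λ i k → M (suc i) (punchIn j k))))

module Submission where

-- The recurrence makes H_n the (0,0) entry of Jⁿ for the tridiagonal matrix J with J(k-1,k) = [k],
-- J(k,k) = x q^k and J(k+1,k) = -q^k. Hence H_(i+j) = Σ_k Jⁱ(0,k) Jʲ(k,0), an LU factorisation of the
-- Hankel matrix: Jⁱ(0,k) = [i][i-1]⋯[i-k+1] H_(i-k) vanishes for k > i and is [k]! for k = i, while
-- Jʲ(k,0) vanishes for k > j and is ∏_(l<k) (-q^l) = (-1)^k q^(k choose 2) for k = j. The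
-- determinant is the product of the two diagonals.

open import Algebra.Bundles using (CommutativeRing)
open import Data.Fin using (Fin; zero; suc; toℕ; punchIn; punchOut; inject₁; fromℕ<; _≟_)
open import Data.Fin.Properties
  using (punchInᵢ≢i; punchIn-injective; punchIn-punchOut; toℕ-injective; toℕ-inject₁; toℕ-fromℕ<; toℕ<n)
open import Data.Nat as ℕ using (ℕ; zero; suc; _≤_; _<_; s≤s; z≤n; _<?_)
import Data.Nat.Properties as ℕₚ
open import Data.Nat.Combinatorics using (_C_; nCk+nC[k+1]≡[n+1]C[k+1]; nC1≡n)
open import Data.Product using (Σ-syntax; _×_; _,_)
open import Data.Sum using (_⊎_; inj₁; inj₂)
open import Data.Vec.Functional using (updateAt)
open import Data.Vec.Functional.Properties using (updateAt-updates; updateAt-minimal; updateAt-commutes)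
open import Function using (_∘_; const)
open import Level using (_⊔_)
open import Relation.Binary.PropositionalEquality as ≡ using (_≡_; _≢_)
open import Relation.Binary.Definitions using (tri<; tri≈; tri>)
open import Relation.Nullary using (yes; no; ¬_; contradiction)

open import Defs

inject₁≢suc : ∀ {n} (c : Fin n) → inject₁ c ≢ suc c
inject₁≢suc c eq = ℕₚ.<⇒≢ (ℕₚ.n<1+n (toℕ c)) (≡.trans (≡.sym (toℕ-inject₁ c)) (≡.cong toℕ eq))

punchIn-inject₁-suc : ∀ {n} (c k : Fin n) →
  punchIn (inject₁ c) k ≡ punchIn (suc c) k ⊎ (punchIn (inject₁ c) k ≡ suc c × punchIn (suc c) k ≡ inject₁ c)
punchIn-inject₁-suc zero    zero    = inj₂ (≡.refl , ≡.refl)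
punchIn-inject₁-suc zero    (suc k) = inj₁ ≡.refl
punchIn-inject₁-suc (suc c) zero    = inj₁ ≡.refl
punchIn-inject₁-suc (suc c) (suc k) with punchIn-inject₁-suc c k
... | inj₁ e          = inj₁ (≡.cong suc e)
... | inj₂ (e₁ , e₂) = inj₂ (≡.cong suc e₁ , ≡.cong suc e₂)

punchIn-adjacent : ∀ {n} (j : Fin (suc (suc n))) (c : Fin (suc n)) → j ≢ inject₁ c → j ≢ suc c →
  Σ[ c′ ∈ Fin n ] (punchIn j (inject₁ c′) ≡ inject₁ c × punchIn j (suc c′) ≡ suc c)
punchIn-adjacent zero             zero    j≢a _   = contradiction ≡.refl j≢a
punchIn-adjacent zero             (suc c) _   _   = c , ≡.refl , ≡.refl
punchIn-adjacent (suc zero)       zero    _   j≢b = contradiction ≡.refl j≢b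
punchIn-adjacent {suc n} (suc (suc j)) zero _ _   = zero , ≡.refl , ≡.refl
punchIn-adjacent {suc n} (suc j)  (suc c) j≢a j≢b
  with punchIn-adjacent j c (j≢a ∘ ≡.cong suc) (j≢b ∘ ≡.cong suc)
... | c′ , e₁ , e₂ = suc c′ , ≡.cong suc e₁ , ≡.cong suc e₂

module BigOperators {c ℓ} (R : CommutativeRing c ℓ) where
  open CommutativeRing R hiding (zero)
  open import Algebra.Properties.Ring ring using (-‿distribˡ-*)
  open import Algebra.Solver.Ring.NaturalCoefficients.Default commutativeSemiring
  open import Relation.Binary.Reasoning.Setoid setoid

  ∑ : (n : ℕ) → (Fin n → Carrier) → Carrier
  ∑ = sumFin R
  syntax ∑ n (λ i → e) = ∑[ i < n ] e

  sumℕ : ℕ → (ℕ → Carrier) → Carrier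
  sumℕ K f = ∑[ k < K ] f (toℕ k)

  sum-cong : ∀ n {f g : Fin n → Carrier} → (∀ j → f j ≈ g j) → ∑ n f ≈ ∑ n g
  sum-cong zero    f≈g = refl
  sum-cong (suc n) f≈g = +-cong (f≈g zero) (sum-cong n (f≈g ∘ suc))

  sum-zero : ∀ n {f : Fin n → Carrier} → (∀ j → f j ≈ 0#) → ∑ n f ≈ 0#
  sum-zero zero    f≈0 = refl
  sum-zero (suc n) f≈0 = trans (+-cong (f≈0 zero) (sum-zero n (f≈0 ∘ suc))) (+-identityˡ 0#)

  sum-*ˡ : ∀ n a (f : Fin n → Carrier) → ∑[ j < n ] (a * f j) ≈ a * ∑ n f
  sum-*ˡ zero    a f = sym (zeroʳ a)
  sum-*ˡ (suc n) a f = trans (+-congˡ (sum-*ˡ n a (f ∘ suc))) (sym (distribˡ a _ _))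

  sum-linear : ∀ n a b (f g : Fin n → Carrier) → ∑[ j < n ] (a * f j + b * g j) ≈ a * ∑ n f + b * ∑ n g
  sum-linear zero    a b f g = solve 2 (λ a b → con 0 := a :* con 0 :+ b :* con 0) refl a b
  sum-linear (suc n) a b f g = trans (+-congˡ (sum-linear n a b (f ∘ suc) (g ∘ suc)))
    (solve 6 (λ a b x y s t → (a :* x :+ b :* y) :+ (a :* s :+ b :* t) := a :* (x :+ s) :+ b :* (y :+ t))
      refl a b (f zero) (g zero) (∑ n (f ∘ suc)) (∑ n (g ∘ suc)))

  sum-remove : ∀ {n} (a : Fin (suc n)) (f : Fin (suc n) → Carrier) →
               ∑ (suc n) f ≈ f a + ∑[ k < n ] f (punchIn a k)
  sum-remove          zero    f = refl
  sum-remove {suc n} (suc a) f = begin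
    f zero + ∑ (suc n) (f ∘ suc)                              ≈⟨ +-congˡ (sum-remove a (f ∘ suc)) ⟩
    f zero + (f (suc a) + ∑[ k < n ] f (suc (punchIn a k)))
      ≈⟨ solve 3 (λ x y s → x :+ (y :+ s) := y :+ (x :+ s)) refl _ _ _ ⟩
    f (suc a) + (f zero + ∑[ k < n ] f (suc (punchIn a k)))  ∎

  sum-single : ∀ {n} (a : Fin n) (f : Fin n → Carrier) → (∀ j → j ≢ a → f j ≈ 0#) → ∑ n f ≈ f a
  sum-single {suc n} a f others = begin
    ∑ (suc n) f                       ≈⟨ sum-remove a f ⟩
    f a + ∑[ k < n ] f (punchIn a k)  ≈⟨ +-congˡ (sum-zero n (λ k → others (punchIn a k) (punchInᵢ≢i a k))) ⟩
    f a + 0#                          ≈⟨ +-identityʳ _ ⟩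
    f a                               ∎

  sum-pair : ∀ {n} (a b : Fin n) (f : Fin n → Carrier) → a ≢ b → (∀ j → j ≢ a → j ≢ b → f j ≈ 0#) →
             ∑ n f ≈ f a + f b
  sum-pair {suc n} a b f a≢b others = begin
    ∑ (suc n) f                       ≈⟨ sum-remove a f ⟩
    f a + ∑[ k < n ] f (punchIn a k)  ≈⟨ +-congˡ (sum-single b′ (f ∘ punchIn a) vanishes) ⟩
    f a + f (punchIn a b′)            ≡⟨ ≡.cong (λ j → f a + f j) (punchIn-punchOut a≢b) ⟩
    f a + f b                         ∎
    where
    b′ = punchOut a≢b
    vanishes : ∀ k → k ≢ b′ → f (punchIn a k) ≈ 0#
    vanishes k k≢b′ = others (punchIn a k) (punchInᵢ≢i a k)
      (λ eq → k≢b′ (punchIn-injective a k b′ (≡.trans eq (≡.sym (punchIn-punchOut a≢b)))))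

  sumℕ-last : ∀ K (f : ℕ → Carrier) → sumℕ (suc K) f ≈ sumℕ K f + f K
  sumℕ-last zero    f = +-comm _ _
  sumℕ-last (suc K) f = trans (+-congˡ (sumℕ-last K (f ∘ suc))) (sym (+-assoc _ _ _))

  prod-cong : ∀ n {f g : ℕ → Carrier} → (∀ k → f k ≈ g k) → prodℕ R n f ≈ prodℕ R n g
  prod-cong zero    f≈g = refl
  prod-cong (suc n) f≈g = *-cong (prod-cong n f≈g) (f≈g n)

  prod-head : ∀ n (f : ℕ → Carrier) → prodℕ R (suc n) f ≈ f 0 * prodℕ R n (f ∘ suc)
  prod-head zero    f = *-comm _ _
  prod-head (suc n) f = trans (*-congʳ (prod-head n f)) (*-assoc _ _ _)

  sign-+ : ∀ m n → sign R (m ℕ.+ n) ≈ sign R m * sign R n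
  sign-+ zero    n = sym (*-identityˡ _)
  sign-+ (suc m) n = trans (-‿cong (sign-+ m n)) (-‿distribˡ-* _ _)

  pow-+ : ∀ a m n → pow R a (m ℕ.+ n) ≈ pow R a m * pow R a n
  pow-+ a zero    n = sym (*-identityˡ _)
  pow-+ a (suc m) n = trans (*-congʳ (pow-+ a m n))
    (solve 3 (λ x y a → x :* y :* a := x :* a :* y) refl (pow R a m) (pow R a n) a)

module Determinants {c ℓ} (R : CommutativeRing c ℓ) where
  open CommutativeRing R hiding (zero)
  open import Algebra.Properties.Ring ring using (-‿distribˡ-*; -‿involutive; -0#≈0#; +-inverseʳ-unique)
  open import Algebra.Solver.Ring.NaturalCoefficients.Default commutativeSemiring
  open import Relation.Binary.Reasoning.Setoid setoid
  open BigOperators R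

  Matrix : ℕ → Set c
  Matrix n = Fin n → Fin n → Carrier

  infix 4 _≈ₘ_
  _≈ₘ_ : ∀ {n} → Matrix n → Matrix n → Set ℓ
  M ≈ₘ N = ∀ i j → M i j ≈ N i j

  column : ∀ {n} → Matrix n → Fin n → Fin n → Carrier
  column M k i = M i k

  minor : ∀ {n} → Matrix (suc n) → Fin (suc n) → Matrix n
  minor M j i k = M (suc i) (punchIn j k)

  laplaceTerm : ∀ {n} → Matrix (suc n) → Fin (suc n) → Carrier
  laplaceTerm {n} M j = sign R (toℕ j) * (M zero j * det R n (minor M j))

  det-cong : ∀ n {M N : Matrix n} → M ≈ₘ N → det R n M ≈ det R n N
  det-cong zero    M≈N = refl
  det-cong (suc n) {M} {N} M≈N = sum-cong (suc n) {laplaceTerm M} {laplaceTerm N} λ j →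
    *-congˡ (*-cong (M≈N zero j) (det-cong n (λ i k → M≈N (suc i) (punchIn j k))))

  infixl 6 _[_]≔_
  _[_]≔_ : ∀ {n} → Matrix n → Fin n → (Fin n → Carrier) → Matrix n
  (M [ t ]≔ v) i = updateAt (M i) t (const (v i))

  replace-updates : ∀ {n} (M : Matrix n) t v i → (M [ t ]≔ v) i t ≡ v i
  replace-updates M t v i = updateAt-updates t (M i)

  replace-minimal : ∀ {n} (M : Matrix n) {t k} v i → k ≢ t → (M [ t ]≔ v) i k ≡ M i k
  replace-minimal M {t} {k} v i k≢t = updateAt-minimal k t (M i) k≢t

  replace-id : ∀ {n} (M : Matrix n) t {v} → (∀ i → v i ≈ M i t) → M [ t ]≔ v ≈ₘ M
  replace-id M t {v} v≈ i k with k ≟ t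
  ... | yes ≡.refl = trans (reflexive (replace-updates M t v i)) (v≈ i)
  ... | no  k≢t    = reflexive (replace-minimal M v i k≢t)

  replace-commutes : ∀ {n} (M : Matrix n) {a b} u v → a ≢ b → M [ a ]≔ u [ b ]≔ v ≈ₘ M [ b ]≔ v [ a ]≔ u
  replace-commutes M {a} {b} u v a≢b i = reflexive ∘ updateAt-commutes b a (a≢b ∘ ≡.sym) (M i)

  minor-replace-self : ∀ {n} (M : Matrix (suc n)) t v → minor (M [ t ]≔ v) t ≈ₘ minor M t
  minor-replace-self M t v i k = reflexive (replace-minimal M v (suc i) (punchInᵢ≢i t k))

  minor-replace-other : ∀ {n} (M : Matrix (suc n)) {t j} v (j≢t : j ≢ t) →
                        minor (M [ t ]≔ v) j ≈ₘ minor M j [ punchOut j≢t ]≔ (v ∘ suc)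
  minor-replace-other M {t} {j} v j≢t i k with k ≟ punchOut j≢t
  ... | yes ≡.refl = reflexive (≡.trans (≡.cong ((M [ t ]≔ v) (suc i)) (punchIn-punchOut j≢t))
                       (≡.trans (replace-updates M t v (suc i)) (≡.sym (replace-updates (minor M j) _ (v ∘ suc) i))))
  ... | no  k≢t′   = reflexive (≡.trans (replace-minimal M v (suc i) punchIn≢t)
                       (≡.sym (replace-minimal (minor M j) (v ∘ suc) i k≢t′)))
    where
    punchIn≢t : punchIn j k ≢ t
    punchIn≢t eq = k≢t′ (punchIn-injective j k _ (≡.trans eq (≡.sym (punchIn-punchOut j≢t))))

  laplaceTerm-replace-self : ∀ {n} (M : Matrix (suc n)) t v →
    laplaceTerm (M [ t ]≔ v) t ≈ sign R (toℕ t) * (v zero * det R n (minor M t))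
  laplaceTerm-replace-self {n} M t v =
    *-congˡ (*-cong (reflexive (replace-updates M t v zero)) (det-cong n (minor-replace-self M t v)))

  laplaceTerm-replace-other : ∀ {n} (M : Matrix (suc n)) {t j} v (j≢t : j ≢ t) →
    laplaceTerm (M [ t ]≔ v) j ≈ sign R (toℕ j) * (M zero j * det R n (minor M j [ punchOut j≢t ]≔ (v ∘ suc)))
  laplaceTerm-replace-other {n} M v j≢t =
    *-congˡ (*-cong (reflexive (replace-minimal M v zero j≢t)) (det-cong n (minor-replace-other M v j≢t)))

  det-linear : ∀ n (M : Matrix n) t a b {w} u v → (∀ i → w i ≈ a * u i + b * v i) →
               det R n (M [ t ]≔ w) ≈ a * det R n (M [ t ]≔ u) + b * det R n (M [ t ]≔ v)
  det-linear (suc n) M t a b {w} u v w≈ = begin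
    ∑ (suc n) (laplaceTerm (M [ t ]≔ w))
      ≈⟨ sum-cong (suc n) term-linear ⟩
    ∑[ j < suc n ] (a * laplaceTerm (M [ t ]≔ u) j + b * laplaceTerm (M [ t ]≔ v) j)
      ≈⟨ sum-linear (suc n) a b (laplaceTerm (M [ t ]≔ u)) (laplaceTerm (M [ t ]≔ v)) ⟩
    a * det R (suc n) (M [ t ]≔ u) + b * det R (suc n) (M [ t ]≔ v) ∎
    where
    term-linear : ∀ j → laplaceTerm (M [ t ]≔ w) j ≈
                        a * laplaceTerm (M [ t ]≔ u) j + b * laplaceTerm (M [ t ]≔ v) j
    term-linear j with j ≟ t
    ... | yes ≡.refl = begin
      laplaceTerm (M [ j ]≔ w) j      ≈⟨ laplaceTerm-replace-self M j w ⟩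
      s * (w zero * D)                ≈⟨ *-congˡ (*-congʳ (w≈ zero)) ⟩
      s * ((a * u zero + b * v zero) * D)
        ≈⟨ solve 6 (λ s a b x y d → s :* ((a :* x :+ b :* y) :* d) := a :* (s :* (x :* d)) :+ b :* (s :* (y :* d)))
             refl s a b (u zero) (v zero) D ⟩
      a * (s * (u zero * D)) + b * (s * (v zero * D))
        ≈⟨ +-cong (*-congˡ (laplaceTerm-replace-self M j u)) (*-congˡ (laplaceTerm-replace-self M j v)) ⟨
      a * laplaceTerm (M [ j ]≔ u) j + b * laplaceTerm (M [ j ]≔ v) j ∎
      where
      s = sign R (toℕ j)
      D = det R n (minor M j)
    ... | no j≢t = begin
      laplaceTerm (M [ t ]≔ w) j                       ≈⟨ laplaceTerm-replace-other M w j≢t ⟩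
      s * (m * det R n (minor M j [ t′ ]≔ (w ∘ suc)))
        ≈⟨ *-congˡ (*-congˡ (det-linear n (minor M j) t′ a b (u ∘ suc) (v ∘ suc) (w≈ ∘ suc))) ⟩
      s * (m * (a * Du + b * Dv))
        ≈⟨ solve 6 (λ s m a b x y → s :* (m :* (a :* x :+ b :* y)) := a :* (s :* (m :* x)) :+ b :* (s :* (m :* y)))
             refl s m a b Du Dv ⟩
      a * (s * (m * Du)) + b * (s * (m * Dv))
        ≈⟨ +-cong (*-congˡ (laplaceTerm-replace-other M u j≢t)) (*-congˡ (laplaceTerm-replace-other M v j≢t)) ⟨
      a * laplaceTerm (M [ t ]≔ u) j + b * laplaceTerm (M [ t ]≔ v) j ∎
      where
      s = sign R (toℕ j)
      m = M zero j
      t′ = punchOut j≢t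
      Du = det R n (minor M j [ t′ ]≔ (u ∘ suc))
      Dv = det R n (minor M j [ t′ ]≔ (v ∘ suc))

  det-additive : ∀ n (M : Matrix n) t u v →
                 det R n (M [ t ]≔ (λ i → u i + v i)) ≈ det R n (M [ t ]≔ u) + det R n (M [ t ]≔ v)
  det-additive n M t u v =
    trans (det-linear n M t 1# 1# u v (λ i → sym (+-cong (*-identityˡ _) (*-identityˡ _))))
          (+-cong (*-identityˡ _) (*-identityˡ _))

  det-columnSum : ∀ n m (M : Matrix n) t (w : Fin m → Carrier) (v : Fin m → Fin n → Carrier) →
    det R n (M [ t ]≔ (λ i → ∑[ k < m ] (w k * v k i))) ≈ ∑[ k < m ] (w k * det R n (M [ t ]≔ v k))
  det-columnSum n zero M t w v =
    trans (det-linear n M t 0# 0# zeros zeros (λ _ → sym (trans (+-cong (zeroˡ 0#) (zeroˡ 0#)) (+-identityˡ 0#))))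
          (trans (+-cong (zeroˡ _) (zeroˡ _)) (+-identityˡ 0#))
    where
    zeros : Fin n → Carrier
    zeros _ = 0#
  det-columnSum n (suc m) M t w v =
    trans (det-linear n M t (w zero) 1# (v zero) rest (λ i → +-congˡ (sym (*-identityˡ _))))
          (+-congˡ (trans (*-identityˡ _) (det-columnSum n m M t (w ∘ suc) (v ∘ suc))))
    where
    rest : Fin n → Carrier
    rest i = ∑[ k < m ] (w (suc k) * v (suc k) i)

  det-adjacent-equal : ∀ {n} (M : Matrix (suc n)) (c : Fin n) → (∀ i → M i (inject₁ c) ≈ M i (suc c)) →
                       det R (suc n) M ≈ 0#
  det-adjacent-equal {suc n} M c equal = begin
    det R (suc (suc n)) M              ≈⟨ sum-pair a b (laplaceTerm M) (inject₁≢suc c) vanishes ⟩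
    laplaceTerm M a + laplaceTerm M b  ≈⟨ +-congʳ (*-cong (reflexive (≡.cong (sign R) (toℕ-inject₁ c)))
                                                          (*-cong (equal zero) (det-cong (suc n) minors-agree))) ⟩
    s * X + - s * X                    ≈⟨ +-congˡ (-‿distribˡ-* s X) ⟨
    s * X + - (s * X)                  ≈⟨ -‿inverseʳ _ ⟩
    0#                                 ∎
    where
    a = inject₁ c
    b = suc c
    s = sign R (toℕ c)
    X = M zero b * det R (suc n) (minor M b)
    vanishes : ∀ j → j ≢ a → j ≢ b → laplaceTerm M j ≈ 0#
    vanishes j j≢a j≢b with punchIn-adjacent j c j≢a j≢b
    ... | c′ , e₁ , e₂ = trans (*-congˡ (*-congˡ (det-adjacent-equal (minor M j) c′ λ i → begin
          M (suc i) (punchIn j (inject₁ c′)) ≡⟨ ≡.cong (M (suc i)) e₁ ⟩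
          M (suc i) a                        ≈⟨ equal (suc i) ⟩
          M (suc i) b                        ≡⟨ ≡.cong (M (suc i)) e₂ ⟨
          M (suc i) (punchIn j (suc c′))     ∎)))
        (trans (*-congˡ (zeroʳ _)) (zeroʳ _))
    minors-agree : minor M a ≈ₘ minor M b
    minors-agree i k with punchIn-inject₁-suc c k
    ... | inj₁ same      = reflexive (≡.cong (M (suc i)) same)
    ... | inj₂ (e₁ , e₂) = begin
      M (suc i) (punchIn a k)  ≡⟨ ≡.cong (M (suc i)) e₁ ⟩
      M (suc i) b              ≈⟨ equal (suc i) ⟨
      M (suc i) a              ≡⟨ ≡.cong (M (suc i)) e₂ ⟨
      M (suc i) (punchIn b k)  ∎

  Alternating : ∀ {n} → Fin n → Fin n → Set (c ⊔ ℓ)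
  Alternating {n} a b = ∀ (M : Matrix n) → (∀ i → M i a ≈ M i b) → det R n M ≈ 0#

  swapColumns : ∀ {n} → Matrix n → Fin n → Fin n → Matrix n
  swapColumns M a b = M [ a ]≔ column M b [ b ]≔ column M a

  swapColumns-first : ∀ {n} (M : Matrix n) {a b} → a ≢ b → ∀ i → swapColumns M a b i a ≡ M i b
  swapColumns-first M {a} {b} a≢b i =
    ≡.trans (replace-minimal (M [ a ]≔ column M b) (column M a) i a≢b) (replace-updates M a (column M b) i)

  swapColumns-other : ∀ {n} (M : Matrix n) {a b k} → k ≢ a → k ≢ b → ∀ i → swapColumns M a b i k ≡ M i k
  swapColumns-other M {a} {b} k≢a k≢b i =
    ≡.trans (replace-minimal (M [ a ]≔ column M b) (column M a) i k≢b) (replace-minimal M (column M b) i k≢a)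

  -- The bilinear form (u, v) ↦ det (M with columns a, b replaced by u, v) vanishes on the diagonal,
  -- hence is antisymmetric.
  det-swapColumns : ∀ {n} {a b : Fin n} → a ≢ b → Alternating a b → ∀ M →
                    det R n (swapColumns M a b) ≈ - det R n M
  det-swapColumns {n} {a} {b} a≢b alternating M = begin
    f (column M b) (column M a)    ≈⟨ +-inverseʳ-unique _ _ (antisymmetric (column M a) (column M b)) ⟩
    - f (column M a) (column M b)  ≈⟨ -‿cong (det-cong n unswapped) ⟩
    - det R n M                    ∎
    where
    f : (u v : Fin n → Carrier) → Carrier
    f u v = det R n (M [ a ]≔ u [ b ]≔ v)
    diagonal : ∀ w → f w w ≈ 0#
    diagonal w = alternating (M [ a ]≔ w [ b ]≔ w) λ i → reflexive (≡.trans
      (≡.trans (replace-minimal (M [ a ]≔ w) w i a≢b) (replace-updates M a w i))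
      (≡.sym (replace-updates (M [ a ]≔ w) b w i)))
    additiveˡ : ∀ u₁ u₂ v → f (λ i → u₁ i + u₂ i) v ≈ f u₁ v + f u₂ v
    additiveˡ u₁ u₂ v = begin
      f (λ i → u₁ i + u₂ i) v                        ≈⟨ det-cong n (replace-commutes M _ v a≢b) ⟩
      det R n (M [ b ]≔ v [ a ]≔ (λ i → u₁ i + u₂ i)) ≈⟨ det-additive n (M [ b ]≔ v) a u₁ u₂ ⟩
      det R n (M [ b ]≔ v [ a ]≔ u₁) + det R n (M [ b ]≔ v [ a ]≔ u₂)
        ≈⟨ +-cong (det-cong n (replace-commutes M u₁ v a≢b)) (det-cong n (replace-commutes M u₂ v a≢b)) ⟨
      f u₁ v + f u₂ v                                ∎
    antisymmetric : ∀ u v → f u v + f v u ≈ 0#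
    antisymmetric u v = begin
      f u v + f v u                                  ≈⟨ +-cong (+-identityˡ _) (+-identityʳ _) ⟨
      (0# + f u v) + (f v u + 0#)                    ≈⟨ +-cong (+-congʳ (diagonal u)) (+-congˡ (diagonal v)) ⟨
      (f u u + f u v) + (f v u + f v v)              ≈⟨ +-cong (det-additive n _ b u v) (det-additive n _ b u v) ⟨
      f u (λ i → u i + v i) + f v (λ i → u i + v i)  ≈⟨ additiveˡ u v _ ⟨
      f (λ i → u i + v i) (λ i → u i + v i)          ≈⟨ diagonal _ ⟩
      0#                                             ∎
    unswapped : M [ a ]≔ column M a [ b ]≔ column M b ≈ₘ M
    unswapped i k = trans (replace-id (M [ a ]≔ column M a) b b-unchanged i k) (replace-id M a (λ _ → refl) i k)
      where
      b-unchanged : ∀ i → M i b ≈ (M [ a ]≔ column M a) i b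
      b-unchanged i = reflexive (≡.sym (replace-minimal M (column M a) i (a≢b ∘ ≡.sym)))

  det-equal-columns-at-distance : ∀ d {n} (M : Matrix n) (a b : Fin n) → suc (toℕ a) ℕ.+ d ≡ toℕ b →
                         (∀ i → M i a ≈ M i b) → det R n M ≈ 0#
  det-equal-columns-at-distance zero    M a (suc c) dist equal =
    det-adjacent-equal M c (λ i → ≡.subst (λ a → M i a ≈ M i (suc c)) a≡ (equal i))
    where
    a≡ : a ≡ inject₁ c
    a≡ = toℕ-injective (≡.trans (≡.sym (ℕₚ.+-identityʳ _))
                                (≡.trans (ℕₚ.suc-injective dist) (≡.sym (toℕ-inject₁ c))))
  det-equal-columns-at-distance (suc d) {n} M a (suc c) dist equal = begin
    det R n M          ≈⟨ -‿involutive _ ⟨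
    - - det R n M      ≈⟨ -‿cong (det-swapColumns (inject₁≢suc c) (λ N → det-adjacent-equal N c) M) ⟨
    - det R n M′       ≈⟨ -‿cong (det-equal-columns-at-distance d M′ a (inject₁ c) dist′ equal′) ⟩
    - 0#               ≈⟨ -0#≈0# ⟩
    0#                 ∎
    where
    M′ = swapColumns M (inject₁ c) (suc c)
    dist″ : suc (toℕ a) ℕ.+ d ≡ toℕ c
    dist″ = ℕₚ.suc-injective (≡.trans (≡.sym (ℕₚ.+-suc _ d)) dist)
    dist′ : suc (toℕ a) ℕ.+ d ≡ toℕ (inject₁ c)
    dist′ = ≡.trans dist″ (≡.sym (toℕ-inject₁ c))
    a<c : toℕ a < toℕ c
    a<c = ℕₚ.≤-trans (ℕₚ.m≤m+n (suc (toℕ a)) d) (ℕₚ.≤-reflexive dist″)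
    a≢c : a ≢ inject₁ c
    a≢c eq = ℕₚ.<⇒≢ a<c (≡.trans (≡.cong toℕ eq) (toℕ-inject₁ c))
    a≢b : a ≢ suc c
    a≢b = ℕₚ.<⇒≢ (ℕₚ.m<n⇒m<1+n a<c) ∘ ≡.cong toℕ
    equal′ : ∀ i → M′ i a ≈ M′ i (inject₁ c)
    equal′ i = begin
      M′ i a            ≡⟨ swapColumns-other M a≢c a≢b i ⟩
      M i a             ≈⟨ equal i ⟩
      M i (suc c)       ≡⟨ swapColumns-first M (inject₁≢suc c) i ⟨
      M′ i (inject₁ c)  ∎

  det-equal-columns : ∀ {n} (M : Matrix n) {a b : Fin n} → a ≢ b → (∀ i → M i a ≈ M i b) → det R n M ≈ 0#
  det-equal-columns M {a} {b} a≢b equal with ℕₚ.<-cmp (toℕ a) (toℕ b)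
  ... | tri< a<b _ _ = let d , dist = ℕₚ.m≤n⇒∃[o]m+o≡n a<b in
                       det-equal-columns-at-distance d M a b dist equal
  ... | tri≈ _ a≡b _ = contradiction (toℕ-injective a≡b) a≢b
  ... | tri> _ _ b<a = let d , dist = ℕₚ.m≤n⇒∃[o]m+o≡n b<a in
                       det-equal-columns-at-distance d M b a dist (sym ∘ equal)

  det-columnCombination : ∀ n (M : Matrix n) t (w : Fin n → Carrier) →
    det R n (M [ t ]≔ (λ i → ∑[ k < n ] (w k * M i k))) ≈ w t * det R n M
  det-columnCombination n M t w = begin
    det R n (M [ t ]≔ (λ i → ∑[ k < n ] (w k * M i k)))  ≈⟨ det-columnSum n n M t w (column M) ⟩
    ∑[ k < n ] (w k * det R n (M [ t ]≔ column M k))     ≈⟨ sum-single t _ copy-vanishes ⟩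
    w t * det R n (M [ t ]≔ column M t)                  ≈⟨ *-congˡ (det-cong n (replace-id M t (λ _ → refl))) ⟩
    w t * det R n M                                      ∎
    where
    copy-vanishes : ∀ k → k ≢ t → w k * det R n (M [ t ]≔ column M k) ≈ 0#
    copy-vanishes k k≢t = trans (*-congˡ (det-equal-columns (M [ t ]≔ column M k) k≢t λ i → reflexive
      (≡.trans (replace-minimal M (column M k) i k≢t) (≡.sym (replace-updates M t (column M k) i)))))
      (zeroʳ _)

  det-lowerTriangular : ∀ n (B : ℕ → ℕ → Carrier) → (∀ i k → i < k → B i k ≈ 0#) →
                        det R n (λ i k → B (toℕ i) (toℕ k)) ≈ prodℕ R n (λ k → B k k)
  det-lowerTriangular zero    B lower = refl
  det-lowerTriangular (suc n) B lower = begin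
    1# * (B 0 0 * det R n B′) + ∑[ j < n ] laplaceTerm (λ i k → B (toℕ i) (toℕ k)) (suc j)
      ≈⟨ +-cong (*-identityˡ _) (sum-zero n first-row-vanishes) ⟩
    B 0 0 * det R n B′ + 0#                      ≈⟨ +-identityʳ _ ⟩
    B 0 0 * det R n B′
      ≈⟨ *-congˡ (det-lowerTriangular n _ λ i k i<k → lower (suc i) (suc k) (s≤s i<k)) ⟩
    B 0 0 * prodℕ R n (λ k → B (suc k) (suc k))  ≈⟨ prod-head n (λ k → B k k) ⟨
    prodℕ R (suc n) (λ k → B k k)                ∎
    where
    B′ : Matrix n
    B′ i k = B (suc (toℕ i)) (suc (toℕ k))
    first-row-vanishes : ∀ j → laplaceTerm (λ i k → B (toℕ i) (toℕ k)) (suc j) ≈ 0#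
    first-row-vanishes j = trans (*-congˡ (trans (*-congʳ (lower 0 _ (s≤s z≤n))) (zeroˡ _))) (zeroʳ _)

  module _ {n} (X : Matrix n) (U : ℕ → ℕ → Carrier) (upper : ∀ k j → j < k → U k j ≈ 0#) where

    XU : Matrix n
    XU i j = ∑[ k < n ] (X i k * U (toℕ k) (toℕ j))

    splice : ℕ → Matrix n
    splice t i j with toℕ j <? t
    ... | yes _ = X i j
    ... | no  _ = XU i j

    splice-< : ∀ t i j → toℕ j < t → splice t i j ≡ X i j
    splice-< t i j j<t with toℕ j <? t
    ... | yes _   = ≡.refl
    ... | no  j≮t = contradiction j<t j≮t

    splice-≮ : ∀ t i j → ¬ toℕ j < t → splice t i j ≡ XU i j
    splice-≮ t i j j≮t with toℕ j <? t
    ... | yes j<t = contradiction j<t j≮t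
    ... | no  _   = ≡.refl

    splice-other : ∀ t i j → toℕ j ≢ t → splice t i j ≡ splice (suc t) i j
    splice-other t i j j≢t with toℕ j <? t
    ... | yes j<t = ≡.sym (splice-< (suc t) i j (ℕₚ.m<n⇒m<1+n j<t))
    ... | no  j≮t = ≡.sym (splice-≮ (suc t) i j λ { (s≤s j≤t) → j≮t (ℕₚ.≤∧≢⇒< j≤t j≢t) })

    -- Column t of splice t is Σ_(k ≤ t) U(k,t) X_k, and the X_k with k ≤ t are columns of splice (suc t).
    det-splice-step : ∀ t → t < n → det R n (splice t) ≈ U t t * det R n (splice (suc t))
    det-splice-step t t<n = begin
      det R n (splice t)                            ≈⟨ det-cong n splice≈combination ⟩
      det R n (splice (suc t) [ tF ]≔ combination)  ≈⟨ det-columnCombination n (splice (suc t)) tF w ⟩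
      U (toℕ tF) t * D                              ≡⟨ ≡.cong (λ s → U s t * D) tF≡t ⟩
      U t t * D                                     ∎
      where
      tF = fromℕ< t<n
      tF≡t : toℕ tF ≡ t
      tF≡t = toℕ-fromℕ< t<n
      D = det R n (splice (suc t))
      w : Fin n → Carrier
      w k = U (toℕ k) t
      combination : Fin n → Carrier
      combination i = ∑[ k < n ] (w k * splice (suc t) i k)
      entry : ∀ i k → X i k * w k ≈ w k * splice (suc t) i k
      entry i k with toℕ k ℕₚ.≤? t
      ... | yes k≤t = trans (*-comm _ _) (*-congˡ (reflexive (≡.sym (splice-< (suc t) i k (s≤s k≤t)))))
      ... | no  k≰t = trans (*-congˡ w≈0) (trans (zeroʳ _) (sym (trans (*-congʳ w≈0) (zeroˡ _))))
        where w≈0 = upper (toℕ k) t (ℕₚ.≰⇒> k≰t)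
      splice≈combination : splice t ≈ₘ splice (suc t) [ tF ]≔ combination
      splice≈combination i j with j ≟ tF
      ... | yes ≡.refl = begin
        splice t i tF                              ≡⟨ splice-≮ t i tF (ℕₚ.<-irrefl tF≡t) ⟩
        ∑[ k < n ] (X i k * U (toℕ k) (toℕ tF))    ≡⟨ ≡.cong (λ s → ∑[ k < n ] (X i k * U (toℕ k) s)) tF≡t ⟩
        ∑[ k < n ] (X i k * w k)                   ≈⟨ sum-cong n (entry i) ⟩
        combination i                              ≡⟨ replace-updates (splice (suc t)) tF combination i ⟨
        (splice (suc t) [ tF ]≔ combination) i tF  ∎
      ... | no j≢tF = reflexive (≡.trans (splice-other t i j j≢t)
                                         (≡.sym (replace-minimal (splice (suc t)) combination i j≢tF)))
        where
        j≢t : toℕ j ≢ t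
        j≢t e = j≢tF (toℕ-injective (≡.trans e (≡.sym tF≡t)))

    det-splice : ∀ t → t ≤ n → det R n (splice 0) ≈ prodℕ R t (λ k → U k k) * det R n (splice t)
    det-splice zero    _   = sym (*-identityˡ _)
    det-splice (suc t) t<n = begin
      det R n (splice 0)                                          ≈⟨ det-splice t (ℕₚ.<⇒≤ t<n) ⟩
      prodℕ R t (λ k → U k k) * det R n (splice t)                 ≈⟨ *-congˡ (det-splice-step t t<n) ⟩
      prodℕ R t (λ k → U k k) * (U t t * det R n (splice (suc t)))  ≈⟨ *-assoc _ _ _ ⟨
      prodℕ R (suc t) (λ k → U k k) * det R n (splice (suc t))     ∎

    det-*-upperTriangular : det R n XU ≈ prodℕ R n (λ k → U k k) * det R n X
    det-*-upperTriangular = begin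
      det R n XU
        ≈⟨ det-cong n (λ i j → reflexive (≡.sym (splice-≮ 0 i j λ ()))) ⟩
      det R n (splice 0)                            ≈⟨ det-splice n ℕₚ.≤-refl ⟩
      prodℕ R n (λ k → U k k) * det R n (splice n)
        ≈⟨ *-congˡ (det-cong n (λ i j → reflexive (splice-< n i j (toℕ<n j)))) ⟩
      prodℕ R n (λ k → U k k) * det R n X           ∎

-- rowStep p = p J and columnStep g = J g for the tridiagonal J with J(k-1,k) = α k, J(k,k) = β k, J(k+1,k) = γ k.
module ThreeTermRecurrence {c ℓ} (R : CommutativeRing c ℓ) (α β γ : ℕ → CommutativeRing.Carrier R) where
  open CommutativeRing R hiding (zero)
  open import Algebra.Solver.Ring.NaturalCoefficients.Default commutativeSemiring
  open import Relation.Binary.Reasoning.Setoid setoid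
  open BigOperators R

  rowStep : (ℕ → Carrier) → ℕ → Carrier
  rowStep p zero    = β 0 * p 0 + γ 0 * p 1
  rowStep p (suc k) = α (suc k) * p k + β (suc k) * p (suc k) + γ (suc k) * p (suc (suc k))

  columnStep : (ℕ → Carrier) → ℕ → Carrier
  columnStep g zero    = β 0 * g 0 + α 1 * g 1
  columnStep g (suc k) = γ k * g k + β (suc k) * g (suc k) + α (suc (suc k)) * g (suc (suc k))

  summation-by-parts : ∀ K (p g : ℕ → Carrier) →
    sumℕ (suc K) (λ k → rowStep p k * g k) + α (suc K) * p K * g (suc K) ≈
    sumℕ (suc K) (λ k → p k * columnStep g k) + γ K * p (suc K) * g K
  summation-by-parts zero p g =
    solve 7 (λ a₁ b₀ c₀ p₀ p₁ g₀ g₁ → ((b₀ :* p₀ :+ c₀ :* p₁) :* g₀ :+ con 0) :+ a₁ :* p₀ :* g₁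
                                     := (p₀ :* (b₀ :* g₀ :+ a₁ :* g₁) :+ con 0) :+ c₀ :* p₁ :* g₀)
      refl (α 1) (β 0) (γ 0) (p 0) (p 1) (g 0) (g 1)
  summation-by-parts (suc K) p g = begin
    sumℕ (suc (suc K)) F + α (suc (suc K)) * p (suc K) * g (suc (suc K))
      ≈⟨ +-congʳ (sumℕ-last (suc K) F) ⟩
    (sumℕ (suc K) F + F (suc K)) + α (suc (suc K)) * p (suc K) * g (suc (suc K))
      ≈⟨ solve 10 (λ S a₁ b₁ c₁ a₂ p₀ p₁ p₂ g₁ g₂ →
              (S :+ (a₁ :* p₀ :+ b₁ :* p₁ :+ c₁ :* p₂) :* g₁) :+ a₂ :* p₁ :* g₂
           := (S :+ a₁ :* p₀ :* g₁) :+ (b₁ :* p₁ :* g₁ :+ c₁ :* p₂ :* g₁ :+ a₂ :* p₁ :* g₂))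
           refl (sumℕ (suc K) F) (α (suc K)) (β (suc K)) (γ (suc K)) (α (suc (suc K)))
                (p K) (p (suc K)) (p (suc (suc K))) (g (suc K)) (g (suc (suc K))) ⟩
    (sumℕ (suc K) F + α (suc K) * p K * g (suc K)) + rest
      ≈⟨ +-congʳ (summation-by-parts K p g) ⟩
    (sumℕ (suc K) G + γ K * p (suc K) * g K) + rest
      ≈⟨ solve 10 (λ S c₀ b₁ c₁ a₂ p₁ p₂ g₀ g₁ g₂ →
              (S :+ c₀ :* p₁ :* g₀) :+ (b₁ :* p₁ :* g₁ :+ c₁ :* p₂ :* g₁ :+ a₂ :* p₁ :* g₂)
           := (S :+ p₁ :* (c₀ :* g₀ :+ b₁ :* g₁ :+ a₂ :* g₂)) :+ c₁ :* p₂ :* g₁)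
           refl (sumℕ (suc K) G) (γ K) (β (suc K)) (γ (suc K)) (α (suc (suc K)))
                (p (suc K)) (p (suc (suc K))) (g K) (g (suc K)) (g (suc (suc K))) ⟩
    (sumℕ (suc K) G + G (suc K)) + γ (suc K) * p (suc (suc K)) * g (suc K)
      ≈⟨ +-congʳ (sumℕ-last (suc K) G) ⟨
    sumℕ (suc (suc K)) G + γ (suc K) * p (suc (suc K)) * g (suc K) ∎
    where
    F G : ℕ → Carrier
    F k = rowStep p k * g k
    G k = p k * columnStep g k
    rest = β (suc K) * p (suc K) * g (suc K) + γ (suc K) * p (suc (suc K)) * g (suc K)
           + α (suc (suc K)) * p (suc K) * g (suc (suc K))

  rowStep-adjoint : ∀ K (p g : ℕ → Carrier) → g K ≈ 0# → g (suc K) ≈ 0# →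
    sumℕ (suc K) (λ k → rowStep p k * g k) ≈ sumℕ (suc K) (λ k → p k * columnStep g k)
  rowStep-adjoint K p g gK≈0 g1+K≈0 = begin
    left                                   ≈⟨ +-identityʳ left ⟨
    left + 0#                              ≈⟨ +-congˡ (trans (*-congˡ g1+K≈0) (zeroʳ _)) ⟨
    left + α (suc K) * p K * g (suc K)     ≈⟨ summation-by-parts K p g ⟩
    right + γ K * p (suc K) * g K          ≈⟨ +-congˡ (trans (*-congˡ gK≈0) (zeroʳ _)) ⟩
    right + 0#                             ≈⟨ +-identityʳ right ⟩
    right                                  ∎
    where
    left = sumℕ (suc K) (λ k → rowStep p k * g k)
    right = sumℕ (suc K) (λ k → p k * columnStep g k)

  unitVector : ℕ → Carrier
  unitVector zero    = 1#
  unitVector (suc k) = 0#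

  columnPower : ℕ → ℕ → Carrier
  columnPower zero    = unitVector
  columnPower (suc j) = columnStep (columnPower j)

  columnPower-vanishes : ∀ j k → j < k → columnPower j k ≈ 0#
  columnPower-vanishes zero    (suc k) _         = refl
  columnPower-vanishes (suc j) (suc k) (s≤s j<k) = begin
    γ k * columnPower j k + β (suc k) * columnPower j (suc k) + α (suc (suc k)) * columnPower j (suc (suc k))
      ≈⟨ +-cong (+-cong (*-congˡ (columnPower-vanishes j k j<k))
                        (*-congˡ (columnPower-vanishes j (suc k) (ℕₚ.m<n⇒m<1+n j<k))))
                (*-congˡ (columnPower-vanishes j (suc (suc k)) (ℕₚ.m<n⇒m<1+n (ℕₚ.m<n⇒m<1+n j<k)))) ⟩
    γ k * 0# + β (suc k) * 0# + α (suc (suc k)) * 0#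
      ≈⟨ solve 3 (λ a b c → a :* con 0 :+ b :* con 0 :+ c :* con 0 := con 0) refl _ _ _ ⟩
    0# ∎

  columnPower-diagonal : ∀ k → columnPower k k ≈ prodℕ R k γ
  columnPower-diagonal zero    = refl
  columnPower-diagonal (suc k) = begin
    γ k * columnPower k k + β (suc k) * columnPower k (suc k) + α (suc (suc k)) * columnPower k (suc (suc k))
      ≈⟨ +-cong (+-cong (*-congˡ (columnPower-diagonal k)) (*-congˡ (columnPower-vanishes k (suc k) (ℕₚ.n<1+n k))))
                (*-congˡ (columnPower-vanishes k (suc (suc k)) (ℕₚ.m<n⇒m<1+n (ℕₚ.n<1+n k)))) ⟩
    γ k * prodℕ R k γ + β (suc k) * 0# + α (suc (suc k)) * 0#
      ≈⟨ solve 4 (λ c P b a → c :* P :+ b :* con 0 :+ a :* con 0 := P :* c) refl _ _ _ _ ⟩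
    prodℕ R k γ * γ k ∎

  hankel-sum : (P : ℕ → ℕ → Carrier) → (∀ i k → P (suc i) k ≈ rowStep (P i) k) →
               ∀ K j i → j < K → sumℕ K (λ k → P i k * columnPower j k) ≈ P (i ℕ.+ j) 0
  hankel-sum P step (suc K) zero i _ = begin
    P i 0 * 1# + sumℕ K (λ k → P i (suc k) * 0#)  ≈⟨ +-cong (*-identityʳ _) (sum-zero K (λ _ → zeroʳ _)) ⟩
    P i 0 + 0#                                   ≈⟨ +-identityʳ _ ⟩
    P i 0                                        ≡⟨ ≡.cong (λ m → P m 0) (ℕₚ.+-identityʳ i) ⟨
    P (i ℕ.+ 0) 0                                ∎
  hankel-sum P step (suc K) (suc j) i (s≤s j<K) = begin
    sumℕ (suc K) (λ k → P i k * columnStep (columnPower j) k)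
      ≈⟨ rowStep-adjoint K (P i) (columnPower j) (columnPower-vanishes j K j<K)
                                                 (columnPower-vanishes j (suc K) (ℕₚ.m<n⇒m<1+n j<K)) ⟨
    sumℕ (suc K) (λ k → rowStep (P i) k * columnPower j k)
      ≈⟨ sum-cong (suc K) {λ k → P (suc i) (toℕ k) * columnPower j (toℕ k)}
                          (λ k → *-congʳ (step i (toℕ k))) ⟨
    sumℕ (suc K) (λ k → P (suc i) k * columnPower j k)
      ≈⟨ hankel-sum P step (suc K) j (suc i) (ℕₚ.m<n⇒m<1+n j<K) ⟩
    P (suc i ℕ.+ j) 0                           ≡⟨ ≡.cong (λ m → P m 0) (ℕₚ.+-suc i j) ⟨
    P (i ℕ.+ suc j) 0                           ∎

module QHermiteHankel {c ℓ} (R : CommutativeRing c ℓ) (q x : CommutativeRing.Carrier R) where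
  open CommutativeRing R hiding (zero)
  open import Algebra.Properties.Ring ring using (-‿distribˡ-*; -‿distribʳ-*; -1*x≈-x; -0#≈0#)
  open import Algebra.Solver.Ring.NaturalCoefficients.Default commutativeSemiring
  open import Relation.Binary.Reasoning.Setoid setoid
  open BigOperators R
  open Determinants R

  H : ℕ → Carrier
  H = hermite R q x

  [_] : ℕ → Carrier
  [ n ] = qint R q n

  open ThreeTermRecurrence R [_] (λ k → x * pow R q k) (λ k → - pow R q k)

  qint-suc : ∀ n → [ suc n ] ≈ 1# + q * [ n ]
  qint-suc n = +-congˡ (trans (sum-cong n (λ _ → *-comm _ _)) (sum-*ˡ n q _))

  qint-one : [ 1 ] ≈ 1#
  qint-one = +-identityʳ 1#

  lowerFactor : ℕ → ℕ → Carrier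
  lowerFactor i       zero    = H i
  lowerFactor zero    (suc k) = 0#
  lowerFactor (suc i) (suc k) = [ suc i ] * lowerFactor i k

  lowerFactor-vanishes : ∀ i k → i < k → lowerFactor i k ≈ 0#
  lowerFactor-vanishes zero    (suc k) _         = refl
  lowerFactor-vanishes (suc i) (suc k) (s≤s i<k) = trans (*-congˡ (lowerFactor-vanishes i k i<k)) (zeroʳ _)

  lowerFactor-diagonal : ∀ k → lowerFactor k k ≈ qfact R q k
  lowerFactor-diagonal zero    = refl
  lowerFactor-diagonal (suc k) = trans (*-congˡ (lowerFactor-diagonal k)) (*-comm _ _)

  lowerDifference : ℕ → ℕ → Carrier
  lowerDifference i k = x * lowerFactor i k - lowerFactor i (suc k)

  lowerDifference-i-zero : ∀ i → lowerDifference i 0 ≈ H (suc i)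
  lowerDifference-i-zero zero    = trans (+-cong (*-identityʳ x) -0#≈0#) (+-identityʳ x)
  lowerDifference-i-zero (suc i) = refl

  lowerDifference-zero-suc : ∀ k → lowerDifference 0 (suc k) ≈ 0#
  lowerDifference-zero-suc k = trans (+-cong (zeroʳ x) -0#≈0#) (+-identityˡ 0#)

  lowerDifference-suc-suc : ∀ i k → lowerDifference (suc i) (suc k) ≈ [ suc i ] * lowerDifference i k
  lowerDifference-suc-suc i k = begin
    x * ([ suc i ] * l) - [ suc i ] * l′      ≈⟨ +-congˡ (-‿distribʳ-* _ _) ⟩
    x * ([ suc i ] * l) + [ suc i ] * - l′
      ≈⟨ solve 4 (λ x a l m → x :* (a :* l) :+ a :* m := a :* (x :* l :+ m)) refl x [ suc i ] l (- l′) ⟩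
    [ suc i ] * (x * l - l′)                  ∎
    where
    l = lowerFactor i k
    l′ = lowerFactor i (suc k)

  -- The q-integer identity [i + 1] = [k + 1] + q^(k+1) [i - k], multiplied by lowerFactor i k = [i]⋯[i-k+1] H_(i-k).
  lowerFactor-qint-split : ∀ i k → pow R q (suc k) * lowerDifference i (suc k) + [ suc k ] * lowerFactor i k
                                   ≈ [ suc i ] * lowerFactor i k
  lowerFactor-qint-split zero zero =
    trans (+-congʳ (trans (*-congˡ (lowerDifference-zero-suc 0)) (zeroʳ _))) (+-identityˡ _)
  lowerFactor-qint-split zero (suc k) = begin
    pow R q (suc (suc k)) * lowerDifference 0 (suc (suc k)) + [ suc (suc k) ] * 0#
      ≈⟨ +-cong (trans (*-congˡ (lowerDifference-zero-suc (suc k))) (zeroʳ _)) (zeroʳ _) ⟩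
    0# + 0#        ≈⟨ +-identityˡ 0# ⟩
    0#             ≈⟨ zeroʳ _ ⟨
    [ 1 ] * 0#     ∎
  lowerFactor-qint-split (suc i) zero = begin
    pow R q 1 * lowerDifference (suc i) 1 + [ 1 ] * H (suc i)
      ≈⟨ +-cong (*-congˡ (trans (lowerDifference-suc-suc i 0) (*-congˡ (lowerDifference-i-zero i))))
                (*-congʳ qint-one) ⟩
    (1# * q) * ([ suc i ] * H (suc i)) + 1# * H (suc i)
      ≈⟨ solve 3 (λ q a h → (con 1 :* q) :* (a :* h) :+ con 1 :* h := (con 1 :+ q :* a) :* h)
           refl q [ suc i ] (H (suc i)) ⟩
    (1# + q * [ suc i ]) * H (suc i)  ≈⟨ *-congʳ (qint-suc (suc i)) ⟨
    [ suc (suc i) ] * H (suc i)       ∎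
  lowerFactor-qint-split (suc i) (suc k) = begin
    pow R q (suc (suc k)) * lowerDifference (suc i) (suc (suc k)) + [ suc (suc k) ] * ([ suc i ] * l)
      ≈⟨ +-cong (*-congˡ (lowerDifference-suc-suc i (suc k))) (*-congʳ (qint-suc (suc k))) ⟩
    (p * q) * ([ suc i ] * d) + (1# + q * [ suc k ]) * ([ suc i ] * l)
      ≈⟨ solve 6 (λ p q a d b l → (p :* q) :* (a :* d) :+ (con 1 :+ q :* b) :* (a :* l)
                                  := a :* (q :* (p :* d :+ b :* l) :+ l))
           refl p q [ suc i ] d [ suc k ] l ⟩
    [ suc i ] * (q * (p * d + [ suc k ] * l) + l)
      ≈⟨ *-congˡ (+-congʳ (*-congˡ (lowerFactor-qint-split i k))) ⟩
    [ suc i ] * (q * ([ suc i ] * l) + l)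
      ≈⟨ solve 3 (λ a q l → a :* (q :* (a :* l) :+ l) := (con 1 :+ q :* a) :* (a :* l)) refl [ suc i ] q l ⟩
    (1# + q * [ suc i ]) * ([ suc i ] * l)  ≈⟨ *-congʳ (qint-suc (suc i)) ⟨
    [ suc (suc i) ] * ([ suc i ] * l)       ∎
    where
    p = pow R q (suc k)
    l = lowerFactor i k
    d = lowerDifference i (suc k)

  lowerFactor-step : ∀ i k → lowerFactor (suc i) k ≈ rowStep (lowerFactor i) k
  lowerFactor-step i zero = begin
    H (suc i)                                         ≈⟨ lowerDifference-i-zero i ⟨
    x * H i + - lowerFactor i 1                       ≈⟨ +-cong (*-congʳ (*-identityʳ x)) (-1*x≈-x _) ⟨
    x * 1# * H i + - 1# * lowerFactor i 1             ∎
  lowerFactor-step i (suc k) = begin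
    [ suc i ] * l                                     ≈⟨ lowerFactor-qint-split i k ⟨
    p * (x * l′ + - l″) + [ suc k ] * l
      ≈⟨ solve 6 (λ p x l′ m a l → p :* (x :* l′ :+ m) :+ a :* l := a :* l :+ x :* p :* l′ :+ p :* m)
           refl p x l′ (- l″) [ suc k ] l ⟩
    [ suc k ] * l + x * p * l′ + p * - l″
      ≈⟨ +-congˡ (trans (sym (-‿distribʳ-* p l″)) (-‿distribˡ-* p l″)) ⟩
    [ suc k ] * l + x * p * l′ + - p * l″             ∎
    where
    p = pow R q (suc k)
    l = lowerFactor i k
    l′ = lowerFactor i (suc k)
    l″ = lowerFactor i (suc (suc k))

  C2-suc : ∀ k → suc k C 2 ≡ k ℕ.+ k C 2
  C2-suc k = ≡.trans (≡.sym (nCk+nC[k+1]≡[n+1]C[k+1] k 1)) (≡.cong (ℕ._+ k C 2) (nC1≡n k))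

  subdiagonal-product : ∀ k → prodℕ R k (λ l → - pow R q l) ≈ sign R k * pow R q (k C 2)
  subdiagonal-product zero    = sym (*-identityʳ 1#)
  subdiagonal-product (suc k) = begin
    prodℕ R k (λ l → - pow R q l) * - pow R q k   ≈⟨ *-congʳ (subdiagonal-product k) ⟩
    (s * P) * - Q                                 ≈⟨ -‿distribʳ-* _ _ ⟨
    - ((s * P) * Q)                               ≈⟨ -‿cong (*-assoc s P Q) ⟩
    - (s * (P * Q))                               ≈⟨ -‿cong (*-congˡ (*-comm P Q)) ⟩
    - (s * (Q * P))                               ≈⟨ -‿distribˡ-* _ _ ⟩
    - s * (Q * P)                                 ≈⟨ *-congˡ (pow-+ q k (k C 2)) ⟨
    - s * pow R q (k ℕ.+ k C 2)                   ≡⟨ ≡.cong (λ m → - s * pow R q m) (C2-suc k) ⟨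
    sign R (suc k) * pow R q (suc k C 2)          ∎
    where
    s = sign R k
    P = pow R q (k C 2)
    Q = pow R q k

  diagonal-product : ∀ n → prodℕ R n (λ k → columnPower k k) ≈ sign R (n C 2) * pow R q (n C 3)
  diagonal-product zero    = sym (*-identityʳ 1#)
  diagonal-product (suc n) = begin
    prodℕ R n (λ k → columnPower k k) * columnPower n n
      ≈⟨ *-cong (diagonal-product n) (trans (columnPower-diagonal n) (subdiagonal-product n)) ⟩
    (sign R (n C 2) * pow R q (n C 3)) * (sign R n * pow R q (n C 2))
      ≈⟨ solve 4 (λ a b c d → (a :* b) :* (c :* d) := (c :* a) :* (d :* b)) refl _ _ _ _ ⟩
    (sign R n * sign R (n C 2)) * (pow R q (n C 2) * pow R q (n C 3))
      ≈⟨ *-cong (sign-+ n (n C 2)) (pow-+ q (n C 2) (n C 3)) ⟨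
    sign R (n ℕ.+ n C 2) * pow R q (n C 2 ℕ.+ n C 3)
      ≡⟨ ≡.cong₂ (λ a b → sign R a * pow R q b) (C2-suc n) (≡.sym (nCk+nC[k+1]≡[n+1]C[k+1] n 2)) ⟨
    sign R (suc n C 2) * pow R q (suc n C 3) ∎

  det-hankel : ∀ n → det R n (λ i j → H (toℕ i ℕ.+ toℕ j)) ≈
                     (sign R (n C 2) * pow R q (n C 3)) * prodℕ R n (λ j → qfact R q j)
  det-hankel n = begin
    det R n (λ i j → H (toℕ i ℕ.+ toℕ j))
      ≈⟨ det-cong n (λ i j → hankel-sum lowerFactor lowerFactor-step n (toℕ j) (toℕ i) (toℕ<n j)) ⟨
    det R n (λ i j → ∑[ k < n ] (lowerFactor (toℕ i) (toℕ k) * columnPower (toℕ j) (toℕ k)))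
      ≈⟨ det-*-upperTriangular {n} (λ i k → lowerFactor (toℕ i) (toℕ k)) (λ k j → columnPower j k)
                                (λ k j → columnPower-vanishes j k) ⟩
    prodℕ R n (λ k → columnPower k k) * det R n (λ i k → lowerFactor (toℕ i) (toℕ k))
      ≈⟨ *-cong (diagonal-product n) (trans (det-lowerTriangular n lowerFactor lowerFactor-vanishes)
                                             (prod-cong n lowerFactor-diagonal)) ⟩
    (sign R (n C 2) * pow R q (n C 3)) * prodℕ R n (λ j → qfact R q j) ∎

open import Data.Nat using (_+_)

mainTheorem9 : ∀ {c ℓ} (R : CommutativeRing c ℓ) (q x : CommutativeRing.Carrier R) (n : ℕ) → 1 ≤ n →
    CommutativeRing._≈_ R
      (det R n (λ i j → hermite R q x (toℕ i + toℕ j)))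
      (CommutativeRing._*_ R (CommutativeRing._*_ R (sign R (n C 2)) (pow R q (n C 3))) (prodℕ R n (λ j → qfact R q j)))
mainTheorem9 R q x n _ = QHermiteHankel.det-hankel R q x n
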